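{- Let $p$ be an odd prime. For every positive integer $k$, $Z_{p^2}(p^{2k})$ is a base-$p^2$ repdigit with $k$ digits.
   Context: $Z_b(m)$ is the number of trailing zeroes in the base-$b$ expansion of $m!$, i.e. the largest $e\ge0$ with $b^e\mid m!$. A base-$b$ repdigit with $k$ digits is a number $\alpha\frac{b^k-1}{b-1}$ with $1\le\alpha\le b-1$. -}

module Defs where

open import Data.Nat using (ℕ; zero; suc; _+_; _*_; _∸_; _^_; _≤_; _!)
open import Data.Nat.Divisibility using (_∣_)

open import Data.Product using (_×_; Σ)
open import Relation.Nullary using (¬_)

-- IsZ b m e : e is the largest exponent with b ^ e ∣ m !,
-- i.e. e = Z_b(m), the number of trailing zeroes of m! in base b.
IsZ : ℕ → ℕ → ℕ → Set
IsZ b m e = (b ^ e ∣ m !) × ¬ (b ^ suc e ∣ m !)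

repunit : ℕ → ℕ → ℕ
repunit b zero = 0
repunit b (suc k) = b ^ k + repunit b k

IsRepdigit : ℕ → ℕ → ℕ → Set
IsRepdigit b k n = Σ ℕ (λ α → (1 ≤ α) × (α ≤ b ∸ 1) × (n ≡ α * repunit b k))
  where open import Relation.Binary.PropositionalEquality using (_≡_)

module Submission where

-- Let p be an odd prime, p = 2a + 1.  By Legendre's formula the exponent of
-- p in (p^m)! is the base-p repunit 1 + p + ... + p^(m-1); we prove this in
-- the multiplicative form (p^m)! = p^(repunit p m) · u with p ∤ u, from the
-- block decomposition (p·q)! = p^q · q! · (unit) of a factorial.
-- For m = 2k, pairing the digits of the repunit gives
--   repunit p (2k) = (1 + p) · repunit (p²) k = 2 · ((a+1) · repunit (p²) k),
-- so (p^(2k))! = (p²)^E · u with E = (a+1) · repunit (p²) k and p² ∤ u.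
-- Such an exact-power factorisation pins down the number of trailing zeroes,
-- so Z_{p²}(p^(2k)) = E, a k-digit repdigit in base p² with digit
-- a + 1 = (p+1)/2, which lies in [1, p² - 1].

open import Defs
open import Data.Nat using (ℕ; suc; _^_; _*_; _≤_)
open import Data.Nat.Primality using (Prime)
open import Data.Product using (Σ; _×_)
open import Relation.Binary.PropositionalEquality using (_≢_)

open import Data.Nat using (zero; _+_; _∸_; _<_; _!; NonZero; s≤s; z≤n; nonTrivial⇒n>1; >-nonZero)
open import Data.Nat.Properties
open import Data.Nat.Divisibility
open import Algebra.Properties.CommutativeSemigroup *-commutativeSemigroup using (x∙yz≈y∙xz)
open import Data.Nat.Primality using (euclidsLemma; prime⇒nonZero; prime⇒irreducible; prime⇒nonTrivial)
open import Data.Nat.Solver using (module +-*-Solver)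
open +-*-Solver using (solve; _:*_; _:+_; con; _:=_)
open import Data.Product using (_,_)
open import Data.Sum using (_⊎_; inj₁; inj₂)
open import Data.Empty using (⊥-elim)
open import Relation.Nullary using (¬_)
open import Relation.Binary.PropositionalEquality

ExactPower : ℕ → ℕ → ℕ → Set
ExactPower b e n = Σ ℕ (λ u → (n ≡ b ^ e * u) × ¬ b ∣ u)

prime⇒1<p : ∀ {p} → Prime p → 1 < p
prime⇒1<p {p} p-prime = nonTrivial⇒n>1 p {{prime⇒nonTrivial p-prime}}

exactPower⇒IsZ : ∀ {b m e} .{{_ : NonZero b}} → ExactPower b e (m !) → IsZ b m e
exactPower⇒IsZ {b} {m} {e} (u , m!≡ , b∤u) = divides u (trans m!≡ (*-comm (b ^ e) u)) , b^1+e∤m!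
  where
    b^1+e∤m! : ¬ b ^ suc e ∣ m !
    b^1+e∤m! d = b∤u (*-cancelˡ-∣ (b ^ e) {{m^n≢0 b e}} (subst₂ _∣_ (*-comm b (b ^ e)) m!≡ d))

module _ {p : ℕ} (p-prime : Prime p) where
  private
    instance
      p≢0 : NonZero p
      p≢0 = prime⇒nonZero p-prime

  p∤1 : ¬ p ∣ 1
  p∤1 p∣1 = <⇒≢ (prime⇒1<p p-prime) (sym (∣1⇒≡1 p∣1))

  ∤-* : ∀ {a b} → ¬ p ∣ a → ¬ p ∣ b → ¬ p ∣ a * b
  ∤-* {a} {b} p∤a p∤b p∣ab with euclidsLemma a b p-prime p∣ab
  ... | inj₁ p∣a = p∤a p∣a
  ... | inj₂ p∣b = p∤b p∣b

  exactPower-square : ∀ {e n} → ExactPower p (2 * e) n → ExactPower (p ^ 2) e n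
  exactPower-square {e} (u , n≡ , p∤u) =
    u , trans n≡ (cong (_* u) (sym (^-*-assoc p 2 e))) , λ p²∣u → p∤u (∣-trans p∣p² p²∣u)
    where
      p∣p² : p ∣ p ^ 2
      p∣p² = divides p (cong (p *_) (*-identityʳ p))

  -- Between consecutive multiples of p no factor divisible by p occurs:
  -- (pq + j)! = (pq)! · W with p ∤ W whenever j < p.
  factorial-block : ∀ q j → j < p → Σ ℕ (λ W → ((p * q + j) ! ≡ (p * q) ! * W) × ¬ p ∣ W)
  factorial-block q zero _ = 1 , trans (cong _! (+-identityʳ (p * q))) (sym (*-identityʳ ((p * q) !))) , p∤1
  factorial-block q (suc j) 1+j<p with factorial-block q j (<⇒≤ 1+j<p)
  ... | W , eq , p∤W = (p * q + suc j) * W , step , ∤-* p∤pq+1+j p∤W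
    where
      p∤pq+1+j : ¬ p ∣ p * q + suc j
      p∤pq+1+j d = <⇒≱ 1+j<p (∣⇒≤ (∣m+n∣m⇒∣n d (m∣m*n q)))
      step : (p * q + suc j) ! ≡ (p * q) ! * ((p * q + suc j) * W)
      step = begin
        (p * q + suc j) !                  ≡⟨ cong _! (+-suc (p * q) j) ⟩
        suc (p * q + j) * (p * q + j) !    ≡⟨ cong₂ _*_ (sym (+-suc (p * q) j)) eq ⟩
        (p * q + suc j) * ((p * q) ! * W)  ≡⟨ x∙yz≈y∙xz (p * q + suc j) ((p * q) !) W ⟩
        (p * q) ! * ((p * q + suc j) * W)  ∎
        where open ≡-Reasoning

  -- (pq)! = p^q · q! · u with p ∤ u: the multiples p, 2p, ..., qp contribute
  -- p^q · q!, and the remaining factors are prime to p.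
  factorial-multiple : ∀ q → Σ ℕ (λ u → ((p * q) ! ≡ p ^ q * q ! * u) × ¬ p ∣ u)
  factorial-multiple zero = 1 , cong _! (*-zeroʳ p) , p∤1
  factorial-multiple (suc q) with factorial-multiple q | factorial-block q (p ∸ 1) (≤-reflexive (suc-pred p))
  ... | u , eqᵤ , p∤u | W , eqW , p∤W = u * W , step , ∤-* p∤u p∤W
    where
      p[1+q]≡ : p * suc q ≡ suc (p * q + (p ∸ 1))
      p[1+q]≡ = begin
        p * suc q               ≡⟨ *-suc p q ⟩
        p + p * q               ≡⟨ +-comm p (p * q) ⟩
        p * q + p               ≡⟨ cong (p * q +_) (sym (suc-pred p)) ⟩
        p * q + suc (p ∸ 1)     ≡⟨ +-suc (p * q) (p ∸ 1) ⟩
        suc (p * q + (p ∸ 1))   ∎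
        where open ≡-Reasoning
      step : (p * suc q) ! ≡ p ^ suc q * suc q ! * (u * W)
      step = begin
        (p * suc q) !                          ≡⟨ cong _! p[1+q]≡ ⟩
        suc (p * q + (p ∸ 1)) * (p * q + (p ∸ 1)) ! ≡⟨ cong₂ _*_ (sym p[1+q]≡) eqW ⟩
        p * suc q * ((p * q) ! * W)            ≡⟨ cong (λ z → p * suc q * (z * W)) eqᵤ ⟩
        p * suc q * (p ^ q * q ! * u * W)      ≡⟨ solve 6 (λ x s y f u w → x :* s :* (y :* f :* u :* w) := x :* y :* (s :* f) :* (u :* w))
                                                        refl p (suc q) (p ^ q) (q !) u W ⟩
        p * p ^ q * (suc q * q !) * (u * W)    ∎
        where open ≡-Reasoning

  factorial-power : ∀ m → ExactPower p (repunit p m) ((p ^ m) !)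
  factorial-power zero = 1 , refl , p∤1
  factorial-power (suc m) with factorial-power m | factorial-multiple (p ^ m)
  ... | v , eqᵥ , p∤v | u , eqᵤ , p∤u = v * u , step , ∤-* p∤v p∤u
    where
      step : (p * p ^ m) ! ≡ p ^ (p ^ m + repunit p m) * (v * u)
      step = begin
        (p * p ^ m) !                           ≡⟨ eqᵤ ⟩
        p ^ (p ^ m) * (p ^ m) ! * u             ≡⟨ cong (λ z → p ^ (p ^ m) * z * u) eqᵥ ⟩
        p ^ (p ^ m) * (p ^ repunit p m * v) * u ≡⟨ solve 4 (λ a b v u → a :* (b :* v) :* u := a :* b :* (v :* u))
                                                         refl (p ^ (p ^ m)) (p ^ repunit p m) v u ⟩
        p ^ (p ^ m) * p ^ repunit p m * (v * u) ≡⟨ cong (_* (v * u)) (sym (^-distribˡ-+-* p (p ^ m) (repunit p m))) ⟩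
        p ^ (p ^ m + repunit p m) * (v * u)     ∎
        where open ≡-Reasoning

-- Grouping the 2k digits of a base-b repunit in pairs gives a base-b² repunit:
-- 1 + b + ... + b^(2k-1) = (1 + b)(1 + b² + ... + b^(2(k-1))).
repunit-even : ∀ b k → repunit b (2 * k) ≡ (1 + b) * repunit (b ^ 2) k
repunit-even b zero = sym (*-zeroʳ (1 + b))
repunit-even b (suc k) = begin
  repunit b (2 * suc k)                         ≡⟨ cong (repunit b) 2[1+k]≡ ⟩
  b * b ^ (2 * k) + (b ^ (2 * k) + repunit b (2 * k)) ≡⟨ cong (λ z → b * z + (z + repunit b (2 * k))) (sym (^-*-assoc b 2 k)) ⟩
  b * X + (X + repunit b (2 * k))               ≡⟨ cong (λ z → b * X + (X + z)) (repunit-even b k) ⟩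
  b * X + (X + (1 + b) * r)                     ≡⟨ solve 3 (λ b x r → b :* x :+ (x :+ (con 1 :+ b) :* r) := (con 1 :+ b) :* (x :+ r))
                                                         refl b X r ⟩
  (1 + b) * (X + r)                             ∎
  where
    open ≡-Reasoning
    X = (b ^ 2) ^ k
    r = repunit (b ^ 2) k
    2[1+k]≡ : 2 * suc k ≡ suc (suc (2 * k))
    2[1+k]≡ = cong suc (+-suc k (k + 0))

even-or-odd : ∀ n → Σ ℕ (λ a → (n ≡ a + a) ⊎ (n ≡ suc (a + a)))
even-or-odd zero = 0 , inj₁ refl
even-or-odd (suc n) with even-or-odd n
... | a , inj₁ n≡ = a , inj₂ (cong suc n≡)
... | a , inj₂ n≡ = suc a , inj₁ (cong suc (trans n≡ (sym (+-suc a a))))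

even-prime : ∀ {p} → Prime p → 2 ∣ p → p ≡ 2
even-prime p-prime 2∣p with prime⇒irreducible p-prime 2∣p
... | inj₁ ()
... | inj₂ 2≡p = sym 2≡p

odd-prime : ∀ {p} → Prime p → p ≢ 2 → Σ ℕ (λ a → p ≡ suc (a + a))
odd-prime {p} p-prime p≢2 with even-or-odd p
... | a , inj₂ p≡ = a , p≡
... | a , inj₁ p≡ = ⊥-elim (p≢2 (even-prime p-prime (divides a (trans p≡ a+a≡a*2))))
  where
    a+a≡a*2 : a + a ≡ a * 2
    a+a≡a*2 = trans (cong (a +_) (sym (+-identityʳ a))) (*-comm 2 a)

half-digit-bound : ∀ {p a} → 1 < p → p ≡ suc (a + a) → suc a ≤ p ^ 2 ∸ 1
half-digit-bound {p} {a} 1<p p≡ = m+n≤o⇒m≤o∸n (suc a) (begin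
  suc a + 1 ≤⟨ +-monoˡ-≤ 1 a<p ⟩
  p + 1     ≡⟨ +-comm p 1 ⟩
  suc p     ≤⟨ m<m*n p (p * 1) {{nonZero}} (subst (1 <_) (sym (*-identityʳ p)) 1<p) ⟩
  p ^ 2     ∎)
  where
    open ≤-Reasoning
    nonZero : NonZero p
    nonZero = >-nonZero (<-trans (s≤s z≤n) 1<p)
    a<p : suc a ≤ p
    a<p = subst (suc a ≤_) (sym p≡) (s≤s (m≤m+n a a))

-- The corollary; the argument does not use the hypothesis 1 ≤ k.
corollary4 : (p : ℕ) → Prime p → p ≢ 2 → (k : ℕ) → 1 ≤ k →
    Σ ℕ (λ e → IsZ (p ^ 2) (p ^ (2 * k)) e × IsRepdigit (p ^ 2) k e)
corollary4 p p-prime p≢2 k _ with odd-prime p-prime p≢2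
... | a , p≡ = E , exactPower⇒IsZ {m = p ^ (2 * k)} {e = E} factorisation
                 , suc a , s≤s z≤n , half-digit-bound (prime⇒1<p p-prime) p≡ , refl
  where
    instance
      p²≢0 : NonZero (p ^ 2)
      p²≢0 = m^n≢0 p 2 {{prime⇒nonZero p-prime}}
    E : ℕ
    E = suc a * repunit (p ^ 2) k
    valuation≡ : repunit p (2 * k) ≡ 2 * E
    valuation≡ = begin
      repunit p (2 * k)                   ≡⟨ repunit-even p k ⟩
      (1 + p) * repunit (p ^ 2) k         ≡⟨ cong (λ x → (1 + x) * repunit (p ^ 2) k) p≡ ⟩
      (2 + (a + a)) * repunit (p ^ 2) k   ≡⟨ solve 2 (λ a r → (con 2 :+ (a :+ a)) :* r := con 2 :* ((con 1 :+ a) :* r))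
                                                   refl a (repunit (p ^ 2) k) ⟩
      2 * E                               ∎
      where open ≡-Reasoning
    factorisation : ExactPower (p ^ 2) E ((p ^ (2 * k)) !)
    factorisation = exactPower-square p-prime {e = E}
      (subst (λ v → ExactPower p v ((p ^ (2 * k)) !)) valuation≡ (factorial-power p-prime (2 * k)))
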